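{- Fix $n\ge1$ and take $\beta=1$. The family of polynomials $\{\mathfrak{G}_Z : Z\in\mathrm{Zig}_n\}$ coincides with the family $\{\widetilde{L}_\alpha(x_1,\ldots,x_n) : \alpha=(\alpha_1,\ldots,\alpha_t)\text{ with } t\le n\}$.
   Context: Indexed forests: a sequence of full binary trees (ordered left/right children), all but finitely many trivial (single node); leaves read left to right across the sequence are labeled $1,2,3,\ldots$; $\mathrm{IN}(F)$ is the set of internal nodes. $\mathrm{QDes}(F)$ is the set of $i$ such that leaves $i,i+1$ are the left and right children of a common internal node. $\mathrm{Zig}_n=\{Z:\mathrm{QDes}(Z)\subseteq\{n\}\}$. Grove polynomials (at $\beta=1$): a set-valued labeling $\kappa$ assigns to each $v\in\mathrm{IN}(F)$ a nonempty finite subset of $\mathbb{Z}_{>0}$; for a leaf $\ell$ set $\kappa(\ell)=\{\ell\}$; compatible if $\max\kappa(v)\le\min\kappa(v_L)$ and $\max\kappa(v)<\min\kappa(v_R)$ for every internal $v$ with children $v_L,v_R$; $\mathfrak{G}_F=\sum_\kappa\prod_v\prod_{j\in\kappa(v)}x_j$ over compatible set-valued labelings. Multi-fundamental quasisymmetric functions (Lam–Pylyavskyy): for a composition $\alpha=(\alpha_1,\ldots,\alpha_t)$ of positive integers with $k=\alpha_1+\cdots+\alpha_t$, $\widetilde{L}_\alpha=\sum_{(S_1,\ldots,S_k)}\prod_{j=1}^k\prod_{i\in S_j}x_i$, summed over sequences of nonempty finite subsets of $\mathbb{Z}_{>0}$ with $\max S_i\le\min S_{i+1}$ for all $i<k$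 and $\max S_i<\min S_{i+1}$ whenever $i\in\{\alpha_1,\alpha_1+\alpha_2,\ldots,\alpha_1+\cdots+\alpha_{t-1}\}$; $\widetilde{L}_\alpha(x_1,\ldots,x_n)$ is its specialization with $x_m=0$ for $m>n$. -}

module Defs where

open import Data.Nat using (ℕ; zero; suc; _+_; _≤_; _⊔_; _⊓_; _≤ᵇ_; _<ᵇ_; _≡ᵇ_)
open import Data.Nat.Properties using (≤-decTotalOrder)
open import Data.Bool using (Bool; true; false; _∧_; if_then_else_)
open import Data.List using (List; []; _∷_; [_]; _++_; map; concat; concatMap; foldr; filterᵇ; length)
open import Data.Bool.ListAction using (any)
open import Data.Nat.ListAction using (sum)
open import Data.List.Relation.Unary.All using (All)
open import Data.List.Relation.Binary.Permutation.Propositional using (_↭_)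
open import Data.List.Sort.MergeSort ≤-decTotalOrder using (mergeSort)
open import Data.List.Sort.Base using (SortingAlgorithm)
open import Relation.Binary.PropositionalEquality using (_≡_)

-- A monomial is a list of variable indices (with multiplicity):
-- [i₁, …, iₘ] stands for x_{i₁} ⋯ x_{iₘ}.  A polynomial is a list of
-- monomials (its terms, counted with multiplicity).

Monomial : Set
Monomial = List ℕ

Poly : Set
Poly = List Monomial

sortℕ : List ℕ → List ℕ
sortℕ = SortingAlgorithm.sort mergeSort

-- Equality of polynomials: same multiset of monomials, where monomials
-- are compared up to reordering of their variables (commutativity).
_≈P_ : Poly → Poly → Set
P ≈P Q = map sortℕ P ↭ map sortℕ Q

subsetsUpTo : ℕ → List (List ℕ)
subsetsUpTo zero    = [ [] ]
subsetsUpTo (suc m) = subsetsUpTo m ++ map (λ S → S ++ [ suc m ]) (subsetsUpTo m)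

isNonempty : List ℕ → Bool
isNonempty []      = false
isNonempty (_ ∷ _) = true

nonemptySubsets : ℕ → List (List ℕ)
nonemptySubsets N = filterᵇ isNonempty (subsetsUpTo N)

maxL : List ℕ → ℕ
maxL = foldr _⊔_ 0

minL : List ℕ → ℕ
minL []       = 0
minL (x ∷ xs) = foldr _⊓_ x xs

data Tree : Set where
  leaf : Tree
  node : Tree → Tree → Tree

leaves : Tree → ℕ
leaves leaf       = 1
leaves (node l r) = leaves l + leaves r

-- An indexed forest is represented by a finite list of trees; it stands
-- for that list followed by infinitely many trivial (single-leaf) trees.
Forest : Set
Forest = List Tree

leavesF : Forest → ℕ
leavesF = foldr (λ t n → leaves t + n) 0

-- QDes.  'cherries s t' lists the i such that leaves i, i+1 of t are the
-- left and right children of a common internal node, where s is the label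
-- of the leftmost leaf of t.
cherry : Tree → Tree → ℕ → List ℕ
cherry leaf leaf s = [ s ]
cherry _    _    s = []

cherries : ℕ → Tree → List ℕ
cherries s leaf       = []
cherries s (node l r) = cherry l r s ++ (cherries s l ++ cherries (s + leaves l) r)

qdesFrom : ℕ → Forest → List ℕ
qdesFrom s []      = []
qdesFrom s (t ∷ F) = cherries s t ++ qdesFrom (s + leaves t) F

QDes : Forest → List ℕ
QDes = qdesFrom 1

InZig : ℕ → Forest → Set
InZig n Z = All (_≡ n) (QDes Z)

data LTree : Set where
  lleaf : LTree
  lnode : List ℕ → LTree → LTree → LTree      -- κ(v), left, right

lleaves : LTree → ℕ
lleaves lleaf         = 1
lleaves (lnode _ l r) = lleaves l + lleaves r

labelingsT : ℕ → Tree → List LTree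
labelingsT N leaf       = [ lleaf ]
labelingsT N (node l r) =
  concatMap (λ S → concatMap (λ L → map (λ R → lnode S L R) (labelingsT N r))
                             (labelingsT N l))
            (nonemptySubsets N)

labelingsF : ℕ → Forest → List (List LTree)
labelingsF N []      = [ [] ]
labelingsF N (t ∷ F) =
  concatMap (λ L → map (λ Ls → L ∷ Ls) (labelingsF N F)) (labelingsT N t)

-- min κ(v), where s is the label of the leftmost leaf below v
-- (for a leaf ℓ, κ(ℓ) = {ℓ})
minκ : ℕ → LTree → ℕ
minκ s lleaf         = s
minκ s (lnode S _ _) = minL S

compatT : ℕ → LTree → Bool
compatT s lleaf         = true
compatT s (lnode S L R) =
  (maxL S ≤ᵇ minκ s L) ∧ (maxL S <ᵇ minκ (s + lleaves L) R)
  ∧ compatT s L ∧ compatT (s + lleaves L) R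

compatF : ℕ → List LTree → Bool
compatF s []       = true
compatF s (L ∷ Ls) = compatT s L ∧ compatF (s + lleaves L) Ls

weightT : LTree → Monomial
weightT lleaf         = []
weightT (lnode S L R) = S ++ (weightT L ++ weightT R)

weightF : List LTree → Monomial
weightF = concatMap weightT

-- Compatibility forces every label of an
-- internal node to be ≤ some leaf label of the (finite part of the)
-- forest, hence ≤ leavesF F; so enumerating labels in {1..leavesF F}
-- loses no compatible labeling.  Trailing trivial trees have no
-- internal nodes and contribute nothing.
grove : Forest → Poly
grove F = map weightF (filterᵇ (compatF 1) (labelingsF (leavesF F) F))

seqs : ℕ → ℕ → List (List (List ℕ))
seqs n zero    = [ [] ]
seqs n (suc k) = concatMap (λ S → map (λ Ss → S ∷ Ss) (seqs n k)) (nonemptySubsets n)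

descents : ℕ → List ℕ → List ℕ
descents acc []           = []
descents acc (a ∷ [])     = []
descents acc (a ∷ b ∷ as) = (acc + a) ∷ descents (acc + a) (b ∷ as)

_∈ᵇ_ : ℕ → List ℕ → Bool
i ∈ᵇ D = any (λ d → d ≡ᵇ i) D

seqOK : List ℕ → ℕ → List (List ℕ) → Bool
seqOK D i []             = true
seqOK D i (S ∷ [])       = true
seqOK D i (S ∷ S' ∷ Ss)  =
  (if i ∈ᵇ D then maxL S <ᵇ minL S' else maxL S ≤ᵇ minL S')
  ∧ seqOK D (suc i) (S' ∷ Ss)

Ltilde : ℕ → List ℕ → Poly
Ltilde n α = map concat (filterᵇ (seqOK (descents 0 α) 1) (seqs n (sum α)))

IsComposition : List ℕ → Set
IsComposition α = All (λ a → 1 ≤ a) α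

-- A nontrivial tree has a cherry, so a forest in Zig_n has at most one
-- nontrivial tree, and that tree has a single cherry, at n: it is a
-- caterpillar, a spine of internal nodes each having a leaf child.  A
-- set-valued labeling of a caterpillar is a sequence of sets read down the
-- spine.  Compatibility makes consecutive sets increase, strictly where the
-- spine continues to the right; given that, the conditions at the leaves
-- just say that all labels are at most n, because the root label is at most
-- the leftmost leaf and every right step of the spine moves the leftmost
-- leaf below it by one.  This is the defining condition of L̃_α(x₁,…,xₙ) for
-- the composition α whose descents are the right steps, and α has at most n
-- parts.  Conversely every such α comes from its caterpillar preceded by
-- n - ℓ(α) trivial trees.
module Submission where

open import Defs
open import Data.Bool using (Bool; true; false; T; T?; _∧_; _∨_; if_then_else_)
open import Data.Bool.Properties using (T-∧)
open import Data.Empty using (⊥-elim)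
open import Data.List
  using (List; []; _∷_; [_]; _++_; length; map; concat; concatMap; foldr; filterᵇ; replicate)
open import Data.List.Properties
  using (∷-injectiveˡ; ∷-injectiveʳ; ++-identityʳ; ++-assoc; map-∘; map-cong; map-cong-local;
         concatMap-cong; concatMap-map; concatMap-pure; map-concatMap; concatMap-++;
         filter-++; filter-none; filter-accept)
open import Data.List.Relation.Unary.All as All using (All; []; _∷_)
open import Data.List.Relation.Unary.All.Properties
  using (map⁺; ++⁺; ++⁻ˡ; ++⁻ʳ; concat⁺; all-filter; filter⁺)
open import Data.List.Relation.Binary.Permutation.Propositional using (↭-reflexive)
open import Data.Nat
  using (ℕ; zero; suc; _+_; _∸_; _≤_; _<_; _⊔_; _⊓_; _≤ᵇ_; _<ᵇ_; _≡ᵇ_; _≤′_; ≤′-refl; ≤′-step;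
         z≤n; s≤s; z<s)
open import Data.Nat.Properties
open import Data.Nat.ListAction using (sum)
open import Data.Product using (Σ; _×_; _,_; proj₁; proj₂)
open import Data.Unit using (tt)
open import Function using (_∘_; Equivalence)
open import Relation.Binary.PropositionalEquality
  using (_≡_; _≢_; ≢-sym; refl; sym; trans; cong; cong₂; subst; module ≡-Reasoning)

T-ext : ∀ {a b} → (T a → T b) → (T b → T a) → a ≡ b
T-ext {true}  {true}  _   _   = refl
T-ext {true}  {false} a⇒b _   = ⊥-elim (a⇒b tt)
T-ext {false} {true}  _   b⇒a = ⊥-elim (b⇒a tt)
T-ext {false} {false} _   _   = refl

T-∧⁻ : ∀ {a b} → T (a ∧ b) → T a × T b
T-∧⁻ = Equivalence.to T-∧

T-∧⁺ : ∀ {a b} → T a → T b → T (a ∧ b)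
T-∧⁺ ta tb = Equivalence.from T-∧ (ta , tb)

module _ {A B : Set} where

  filterᵇ-map : ∀ (p : B → Bool) (f : A → B) xs →
    filterᵇ p (map f xs) ≡ map f (filterᵇ (p ∘ f) xs)
  filterᵇ-map p f []       = refl
  filterᵇ-map p f (x ∷ xs) with p (f x)
  ... | true  = cong (f x ∷_) (filterᵇ-map p f xs)
  ... | false = filterᵇ-map p f xs

  filterᵇ-concatMap : ∀ (p : B → Bool) (f : A → List B) xs →
    filterᵇ p (concatMap f xs) ≡ concatMap (filterᵇ p ∘ f) xs
  filterᵇ-concatMap p f []       = refl
  filterᵇ-concatMap p f (x ∷ xs) =
    trans (filter-++ (T? ∘ p) (f x) _) (cong (filterᵇ p (f x) ++_) (filterᵇ-concatMap p f xs))

  concatMap-[_]∘ : ∀ (f : A → B) xs → concatMap (λ x → [ f x ]) xs ≡ map f xs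
  concatMap-[_]∘ f xs = trans (sym (concatMap-map [_] f xs)) (concatMap-pure (map f xs))

  concatMap-all-[] : ∀ {f : A → List B} {xs} → All (λ x → f x ≡ []) xs → concatMap f xs ≡ []
  concatMap-all-[] []       = refl
  concatMap-all-[] (e ∷ es) = cong₂ _++_ e (concatMap-all-[] es)

filterᵇ-cong-local : ∀ {A : Set} {p q : A → Bool} {xs} →
  All (λ x → p x ≡ q x) xs → filterᵇ p xs ≡ filterᵇ q xs
filterᵇ-cong-local [] = refl
filterᵇ-cong-local {p = p} {q} {x ∷ _} (e ∷ es) with p x | q x | e
... | true  | .true  | refl = cong (x ∷_) (filterᵇ-cong-local es)
... | false | .false | refl = filterᵇ-cong-local es

minL≤maxL : ∀ S → minL S ≤ maxL S
minL≤maxL []       = z≤n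
minL≤maxL (x ∷ xs) = ≤-trans (foldr-⊓≤ x xs) (m≤m⊔n x (maxL xs))
  where
  foldr-⊓≤ : ∀ x xs → foldr _⊓_ x xs ≤ x
  foldr-⊓≤ x []       = ≤-refl
  foldr-⊓≤ x (y ∷ ys) = ≤-trans (m⊓n≤n y _) (foldr-⊓≤ x ys)

maxL-++ : ∀ xs ys → maxL (xs ++ ys) ≡ maxL xs ⊔ maxL ys
maxL-++ []       ys = refl
maxL-++ (x ∷ xs) ys = trans (cong (x ⊔_) (maxL-++ xs ys)) (sym (⊔-assoc x (maxL xs) (maxL ys)))

maxL-snoc : ∀ {m} S → maxL S ≤ m → maxL (S ++ [ m ]) ≡ m
maxL-snoc {m} S S≤m = begin
  maxL (S ++ [ m ])  ≡⟨ maxL-++ S [ m ] ⟩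
  maxL S ⊔ (m ⊔ 0)   ≡⟨ cong (maxL S ⊔_) (⊔-identityʳ m) ⟩
  maxL S ⊔ m         ≡⟨ m≤n⇒m⊔n≡n S≤m ⟩
  m                  ∎
  where open ≡-Reasoning

subsetsUpTo-bounded : ∀ m → All (λ S → maxL S ≤ m) (subsetsUpTo m)
subsetsUpTo-bounded zero    = z≤n ∷ []
subsetsUpTo-bounded (suc m) =
  ++⁺ (All.map m≤n⇒m≤1+n (subsetsUpTo-bounded m))
      (map⁺ (All.map (λ {S} S≤m → ≤-reflexive (maxL-snoc S (m≤n⇒m≤1+n S≤m)))
                     (subsetsUpTo-bounded m)))

subsetsUpTo-extend : ∀ {n N} → n ≤′ N →
  Σ (List (List ℕ)) λ R → subsetsUpTo N ≡ subsetsUpTo n ++ R × All (λ S → n < maxL S) R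
subsetsUpTo-extend ≤′-refl = [] , sym (++-identityʳ _) , []
subsetsUpTo-extend {n} (≤′-step {N} n≤N) =
  let R , e , big = subsetsUpTo-extend n≤N
      new = map (_++ [ suc N ]) (subsetsUpTo N)
  in R ++ new ,
     trans (cong (_++ new) e) (++-assoc (subsetsUpTo n) R new) ,
     ++⁺ big (map⁺ (All.map (λ {S} S≤N → subst (n <_) (sym (maxL-snoc S (m≤n⇒m≤1+n S≤N)))
                                                   (s≤s (≤′⇒≤ n≤N)))
                            (subsetsUpTo-bounded N)))

IsLabel : ℕ → List ℕ → Set
IsLabel n S = T (isNonempty S) × maxL S ≤ n

nonemptySubsets-labels : ∀ n → All (IsLabel n) (nonemptySubsets n)
nonemptySubsets-labels n =
  All.zip (all-filter (T? ∘ isNonempty) (subsetsUpTo n) ,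
           filter⁺ (T? ∘ isNonempty) (subsetsUpTo-bounded n))

seqs-labels : ∀ n k → All (λ ss → length ss ≡ k × All (IsLabel n) ss) (seqs n k)
seqs-labels n zero    = (refl , []) ∷ []
seqs-labels n (suc k) =
  concat⁺ (map⁺ (All.map (λ S-label → map⁺ (All.map (λ (l , labels) → cong suc l , S-label ∷ labels)
                                                      (seqs-labels n k)))
                         (nonemptySubsets-labels n)))

map-seqs-suc : ∀ {A : Set} N k (g : List (List ℕ) → A) {f : List ℕ → List A} →
  (∀ S → f S ≡ map (g ∘ (S ∷_)) (seqs N k)) →
  concatMap f (nonemptySubsets N) ≡ map g (seqs N (suc k))
map-seqs-suc N k g root =
  trans (concatMap-cong (λ S → trans (root S) (map-∘ (seqs N k))) (nonemptySubsets N))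
        (sym (map-concatMap g _ (nonemptySubsets N)))

seqs-restrict : ∀ {n N} → n ≤′ N → ∀ k (Q : List (List ℕ) → Bool) →
  (∀ ss → length ss ≡ k → T (Q ss) → All (λ S → maxL S ≤ n) ss) →
  filterᵇ Q (seqs N k) ≡ filterᵇ Q (seqs n k)
seqs-restrict n≤N zero    Q bounded = refl
seqs-restrict {n} {N} n≤N (suc k) Q bounded = begin
  filterᵇ Q (seqs N (suc k))                                    ≡⟨ unfold N ⟩
  concatMap (rooted N) (nonemptySubsets N)                      ≡⟨ cong (concatMap (rooted N)) split ⟩
  concatMap (rooted N) (nonemptySubsets n ++ filterᵇ isNonempty R)
    ≡⟨ concatMap-++ (rooted N) (nonemptySubsets n) _ ⟩
  concatMap (rooted N) (nonemptySubsets n) ++ concatMap (rooted N) (filterᵇ isNonempty R)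
    ≡⟨ cong₂ _++_ (concatMap-cong restricted (nonemptySubsets n))
                  (concatMap-all-[] (filter⁺ (T? ∘ isNonempty) (All.map rooted-big big))) ⟩
  concatMap (rooted n) (nonemptySubsets n) ++ []                ≡⟨ ++-identityʳ _ ⟩
  concatMap (rooted n) (nonemptySubsets n)                      ≡⟨ unfold n ⟨
  filterᵇ Q (seqs n (suc k))                                    ∎
  where
  open ≡-Reasoning
  rooted : ℕ → List ℕ → List (List (List ℕ))
  rooted M S = map (S ∷_) (filterᵇ (Q ∘ (S ∷_)) (seqs M k))

  unfold : ∀ M → filterᵇ Q (seqs M (suc k)) ≡ concatMap (rooted M) (nonemptySubsets M)
  unfold M = trans (filterᵇ-concatMap Q _ (nonemptySubsets M))
                   (concatMap-cong (λ S → filterᵇ-map Q (S ∷_) (seqs M k)) (nonemptySubsets M))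

  R = proj₁ (subsetsUpTo-extend n≤N)
  big = proj₂ (proj₂ (subsetsUpTo-extend n≤N))

  split : nonemptySubsets N ≡ nonemptySubsets n ++ filterᵇ isNonempty R
  split = trans (cong (filterᵇ isNonempty) (proj₁ (proj₂ (subsetsUpTo-extend n≤N))))
                (filter-++ (T? ∘ isNonempty) (subsetsUpTo n) R)

  restricted : ∀ S → rooted N S ≡ rooted n S
  restricted S = cong (map (S ∷_)) (seqs-restrict n≤N k (Q ∘ (S ∷_))
                   (λ ss l q → All.tail (bounded (S ∷ ss) (cong suc l) q)))

  rooted-big : ∀ {S} → n < maxL S → rooted N S ≡ []
  rooted-big {S} n<S = cong (map (S ∷_)) (filter-none (T? ∘ Q ∘ (S ∷_))
    (All.map (λ {ss} (l , _) q → <⇒≱ n<S (All.head (bounded (S ∷ ss) (cong suc l) q)))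
             (seqs-labels N k)))

-- Caterpillars

caterpillar : List Bool → Tree
caterpillar []           = node leaf leaf
caterpillar (true  ∷ bs) = node leaf (caterpillar bs)
caterpillar (false ∷ bs) = node (caterpillar bs) leaf

trues : List Bool → ℕ
trues []           = 0
trues (true  ∷ bs) = suc (trues bs)
trues (false ∷ bs) = trues bs

labelCaterpillar : List Bool → List (List ℕ) → LTree
labelCaterpillar bs           []       = lleaf
labelCaterpillar []           (S ∷ _)  = lnode S lleaf lleaf
labelCaterpillar (true  ∷ bs) (S ∷ ss) = lnode S lleaf (labelCaterpillar bs ss)
labelCaterpillar (false ∷ bs) (S ∷ ss) = lnode S (labelCaterpillar bs ss) lleaf

stepᵇ : Bool → List ℕ → List ℕ → Bool
stepᵇ strict S S′ = if strict then maxL S <ᵇ minL S′ else maxL S ≤ᵇ minL S′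

chainᵇ : List Bool → List (List ℕ) → Bool
chainᵇ (b ∷ bs) (S ∷ S′ ∷ ss) = stepᵇ b S S′ ∧ chainᵇ bs (S′ ∷ ss)
chainᵇ _        _             = true

labelingsT-caterpillar : ∀ N bs →
  labelingsT N (caterpillar bs) ≡ map (labelCaterpillar bs) (seqs N (suc (length bs)))
labelingsT-caterpillar N [] =
  map-seqs-suc N 0 (labelCaterpillar []) (λ S → ++-identityʳ _)
labelingsT-caterpillar N (true ∷ bs) =
  map-seqs-suc N (suc (length bs)) (labelCaterpillar (true ∷ bs)) λ S →
    trans (++-identityʳ _)
          (trans (cong (map (lnode S lleaf)) (labelingsT-caterpillar N bs)) (sym (map-∘ _)))
labelingsT-caterpillar N (false ∷ bs) =
  map-seqs-suc N (suc (length bs)) (labelCaterpillar (false ∷ bs)) λ S →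
    trans (concatMap-[_]∘ (λ L → lnode S L lleaf) _)
          (trans (cong (map (λ L → lnode S L lleaf)) (labelingsT-caterpillar N bs)) (sym (map-∘ _)))

weightT-labelCaterpillar : ∀ bs ss → length ss ≡ suc (length bs) →
  weightT (labelCaterpillar bs ss) ≡ concat ss
weightT-labelCaterpillar []           (S ∷ [])  _ = refl
weightT-labelCaterpillar (true  ∷ bs) (S ∷ ss) l =
  cong (S ++_) (weightT-labelCaterpillar bs ss (suc-injective l))
weightT-labelCaterpillar (false ∷ bs) (S ∷ ss) l =
  cong (S ++_) (trans (++-identityʳ _) (weightT-labelCaterpillar bs ss (suc-injective l)))

minκ-labelCaterpillar : ∀ s bs S ss → minκ s (labelCaterpillar bs (S ∷ ss)) ≡ minL S
minκ-labelCaterpillar s []          S ss = refl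
minκ-labelCaterpillar s (true  ∷ _) S ss = refl
minκ-labelCaterpillar s (false ∷ _) S ss = refl

lleaves-positive : ∀ L → 0 < lleaves L
lleaves-positive lleaf         = z<s
lleaves-positive (lnode _ L R) = ≤-trans (lleaves-positive L) (m≤m+n (lleaves L) (lleaves R))

compatT-node⁻ : ∀ s S L R → T (compatT s (lnode S L R)) →
  maxL S ≤ minκ s L × maxL S < minκ (s + lleaves L) R ×
  T (compatT s L) × T (compatT (s + lleaves L) R)
compatT-node⁻ s S L R c =
  let S≤L , c₁ = T-∧⁻ c
      S<R , c₂ = T-∧⁻ c₁
      cL , cR  = T-∧⁻ c₂
  in ≤ᵇ⇒≤ (maxL S) _ S≤L , <ᵇ⇒< (maxL S) _ S<R , cL , cR

compatT-node⁺ : ∀ s S L R → maxL S ≤ minκ s L → maxL S < minκ (s + lleaves L) R →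
  T (compatT s L) → T (compatT (s + lleaves L) R) → T (compatT s (lnode S L R))
compatT-node⁺ s S L R S≤L S<R cL cR = T-∧⁺ (≤⇒≤ᵇ S≤L) (T-∧⁺ (<⇒<ᵇ S<R) (T-∧⁺ cL cR))

compatT-root : ∀ s bs S ss → T (compatT s (labelCaterpillar bs (S ∷ ss))) → maxL S ≤ s
compatT-root s []           S ss         c = proj₁ (compatT-node⁻ s S lleaf lleaf c)
compatT-root s (true  ∷ bs) S ss         c =
  proj₁ (compatT-node⁻ s S lleaf (labelCaterpillar bs ss) c)
compatT-root s (false ∷ bs) S []         c = proj₁ (compatT-node⁻ s S lleaf lleaf c)
compatT-root s (false ∷ bs) S (S′ ∷ ss) c =
  let S≤S′ , _ , c′ , _ = compatT-node⁻ s S (labelCaterpillar bs (S′ ∷ ss)) lleaf c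
  in begin
    maxL S   ≤⟨ S≤S′ ⟩
    minκ s (labelCaterpillar bs (S′ ∷ ss)) ≡⟨ minκ-labelCaterpillar s bs S′ ss ⟩
    minL S′  ≤⟨ minL≤maxL S′ ⟩
    maxL S′  ≤⟨ compatT-root s bs S′ ss c′ ⟩
    s        ∎
  where open ≤-Reasoning

compatT⇒bounded : ∀ s bs ss → length ss ≡ suc (length bs) →
  T (compatT s (labelCaterpillar bs ss)) → All (λ S → maxL S ≤ s + trues bs) ss
compatT⇒bounded s [] (S ∷ []) _ c = ≤-trans (compatT-root s [] S [] c) (m≤m+n s 0) ∷ []
compatT⇒bounded s (true ∷ bs) (S ∷ ss) l c =
  let _ , _ , _ , c′ = compatT-node⁻ s S lleaf (labelCaterpillar bs ss) c
  in ≤-trans (compatT-root s (true ∷ bs) S ss c) (m≤m+n s _) ∷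
     All.map (λ S≤ → ≤-trans S≤ (≤-reflexive (+-assoc s 1 (trues bs))))
             (compatT⇒bounded (s + 1) bs ss (suc-injective l) c′)
compatT⇒bounded s (false ∷ bs) (S ∷ ss) l c =
  let _ , _ , c′ , _ = compatT-node⁻ s S (labelCaterpillar bs ss) lleaf c
  in ≤-trans (compatT-root s (false ∷ bs) S ss c) (m≤m+n s _) ∷
     compatT⇒bounded s bs ss (suc-injective l) c′

compatT⇒chainᵇ : ∀ s bs ss → T (compatT s (labelCaterpillar bs ss)) → T (chainᵇ bs ss)
compatT⇒chainᵇ s []           _              _ = tt
compatT⇒chainᵇ s (_ ∷ _)      []             _ = tt
compatT⇒chainᵇ s (_ ∷ _)      (_ ∷ [])       _ = tt
compatT⇒chainᵇ s (true  ∷ bs) (S ∷ S′ ∷ ss) c =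
  let _ , S<S′ , _ , c′ = compatT-node⁻ s S lleaf (labelCaterpillar bs (S′ ∷ ss)) c
  in T-∧⁺ (<⇒<ᵇ (subst (maxL S <_) (minκ-labelCaterpillar (s + 1) bs S′ ss) S<S′))
          (compatT⇒chainᵇ (s + 1) bs (S′ ∷ ss) c′)
compatT⇒chainᵇ s (false ∷ bs) (S ∷ S′ ∷ ss) c =
  let S≤S′ , _ , c′ , _ = compatT-node⁻ s S (labelCaterpillar bs (S′ ∷ ss)) lleaf c
  in T-∧⁺ (≤⇒≤ᵇ (subst (maxL S ≤_) (minκ-labelCaterpillar s bs S′ ss) S≤S′))
          (compatT⇒chainᵇ s bs (S′ ∷ ss) c′)

chainᵇ⇒compatT : ∀ s bs ss → length ss ≡ suc (length bs) →
  All (λ S → maxL S ≤ s + trues bs) ss → T (chainᵇ bs ss) → T (compatT s (labelCaterpillar bs ss))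
chainᵇ⇒compatT s [] (S ∷ []) _ (S≤ ∷ []) _ =
  compatT-node⁺ s S lleaf lleaf S≤s (≤-<-trans S≤s (m<m+n s z<s)) tt tt
  where S≤s = ≤-trans S≤ (≤-reflexive (+-identityʳ s))
chainᵇ⇒compatT s (true ∷ bs) (S ∷ S′ ∷ ss) l (_ ∷ bounded) ch =
  compatT-node⁺ s S lleaf R S≤s (subst (maxL S <_) (sym (minκ-labelCaterpillar (s + 1) bs S′ ss)) S<S′) tt c′
  where
  R = labelCaterpillar bs (S′ ∷ ss)
  S<S′ = <ᵇ⇒< (maxL S) _ (proj₁ (T-∧⁻ ch))
  c′ = chainᵇ⇒compatT (s + 1) bs (S′ ∷ ss) (suc-injective l)
         (All.map (λ S≤ → ≤-trans S≤ (≤-reflexive (sym (+-assoc s 1 (trues bs))))) bounded)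
         (proj₂ (T-∧⁻ ch))
  S≤s : maxL S ≤ s
  S≤s = ≤-pred (begin
    suc (maxL S) ≤⟨ S<S′ ⟩
    minL S′      ≤⟨ minL≤maxL S′ ⟩
    maxL S′      ≤⟨ compatT-root (s + 1) bs S′ ss c′ ⟩
    s + 1        ≡⟨ +-comm s 1 ⟩
    suc s        ∎)
    where open ≤-Reasoning
chainᵇ⇒compatT s (false ∷ bs) (S ∷ S′ ∷ ss) l (_ ∷ bounded) ch =
  compatT-node⁺ s S L lleaf (subst (maxL S ≤_) (sym (minκ-labelCaterpillar s bs S′ ss)) S≤S′) S<leaf c′ tt
  where
  L = labelCaterpillar bs (S′ ∷ ss)
  S≤S′ = ≤ᵇ⇒≤ (maxL S) _ (proj₁ (T-∧⁻ ch))
  c′ = chainᵇ⇒compatT s bs (S′ ∷ ss) (suc-injective l) bounded (proj₂ (T-∧⁻ ch))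
  S<leaf : maxL S < s + lleaves L
  S<leaf = begin-strict
    maxL S          ≤⟨ S≤S′ ⟩
    minL S′         ≤⟨ minL≤maxL S′ ⟩
    maxL S′         ≤⟨ compatT-root s bs S′ ss c′ ⟩
    s               <⟨ m<m+n s (lleaves-positive L) ⟩
    s + lleaves L   ∎
    where open ≤-Reasoning

compatT≡chainᵇ : ∀ s bs ss → length ss ≡ suc (length bs) →
  All (λ S → maxL S ≤ s + trues bs) ss → compatT s (labelCaterpillar bs ss) ≡ chainᵇ bs ss
compatT≡chainᵇ s bs ss l bounded =
  T-ext (compatT⇒chainᵇ s bs ss) (chainᵇ⇒compatT s bs ss l bounded)

treeGrove : ℕ → ℕ → Tree → Poly
treeGrove N s t = map weightT (filterᵇ (compatT s) (labelingsT N t))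

treeGrove-caterpillar : ∀ {N} s bs → s + trues bs ≤′ N →
  treeGrove N s (caterpillar bs) ≡
  map concat (filterᵇ (chainᵇ bs) (seqs (s + trues bs) (suc (length bs))))
treeGrove-caterpillar {N} s bs n≤N = begin
  map weightT (filterᵇ (compatT s) (labelingsT N (caterpillar bs)))
    ≡⟨ cong (map weightT ∘ filterᵇ (compatT s)) (labelingsT-caterpillar N bs) ⟩
  map weightT (filterᵇ (compatT s) (map (labelCaterpillar bs) (seqs N k)))
    ≡⟨ cong (map weightT) (filterᵇ-map (compatT s) (labelCaterpillar bs) (seqs N k)) ⟩
  map weightT (map (labelCaterpillar bs) (filterᵇ compatible (seqs N k)))
    ≡⟨ cong (map weightT ∘ map (labelCaterpillar bs))
            (seqs-restrict n≤N k compatible (compatT⇒bounded s bs)) ⟩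
  map weightT (map (labelCaterpillar bs) (filterᵇ compatible (seqs n k)))
    ≡⟨ map-∘ _ ⟨
  map (weightT ∘ labelCaterpillar bs) (filterᵇ compatible (seqs n k))
    ≡⟨ map-cong-local (filter⁺ (T? ∘ compatible)
         (All.map (λ {ss} (l , _) → weightT-labelCaterpillar bs ss l) (seqs-labels n k))) ⟩
  map concat (filterᵇ compatible (seqs n k))
    ≡⟨ cong (map concat) (filterᵇ-cong-local
         (All.map (λ {ss} (l , labels) → compatT≡chainᵇ s bs ss l (All.map proj₂ labels))
                  (seqs-labels n k))) ⟩
  map concat (filterᵇ (chainᵇ bs) (seqs n k)) ∎
  where
  open ≡-Reasoning
  n = s + trues bs
  k = suc (length bs)
  compatible = compatT s ∘ labelCaterpillar bs

-- Compositions

firstPart : List Bool → ℕ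
firstPart []           = 1
firstPart (true  ∷ bs) = 1
firstPart (false ∷ bs) = suc (firstPart bs)

laterParts : List Bool → List ℕ
laterParts []           = []
laterParts (true  ∷ bs) = firstPart bs ∷ laterParts bs
laterParts (false ∷ bs) = laterParts bs

-- The composition of 1 + length bs whose descents are the i with bs ! (i - 1) ≡ true.
compositionOf : List Bool → List ℕ
compositionOf bs = firstPart bs ∷ laterParts bs

sum-compositionOf : ∀ bs → sum (compositionOf bs) ≡ suc (length bs)
sum-compositionOf []           = refl
sum-compositionOf (true  ∷ bs) = cong suc (sum-compositionOf bs)
sum-compositionOf (false ∷ bs) = cong suc (sum-compositionOf bs)

length-compositionOf : ∀ bs → length (compositionOf bs) ≡ suc (trues bs)
length-compositionOf []           = refl
length-compositionOf (true  ∷ bs) = cong suc (length-compositionOf bs)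
length-compositionOf (false ∷ bs) = length-compositionOf bs

compositionOf-isComposition : ∀ bs → IsComposition (compositionOf bs)
compositionOf-isComposition []           = s≤s z≤n ∷ []
compositionOf-isComposition (true  ∷ bs) = s≤s z≤n ∷ compositionOf-isComposition bs
compositionOf-isComposition (false ∷ bs) = s≤s z≤n ∷ All.tail (compositionOf-isComposition bs)

compositionOf-surjective : ∀ {a α} → IsComposition (a ∷ α) →
  Σ (List Bool) λ bs → compositionOf bs ≡ a ∷ α
compositionOf-surjective {zero}        (() ∷ _)
compositionOf-surjective {suc zero}    {[]}    _            = [] , refl
compositionOf-surjective {suc zero}    {_ ∷ _} (_ ∷ parts) =
  let bs , e = compositionOf-surjective parts in true ∷ bs , cong (1 ∷_) e
compositionOf-surjective {suc (suc a)} {α}     (_ ∷ parts) =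
  let bs , e = compositionOf-surjective {suc a} (s≤s z≤n ∷ parts)
  in false ∷ bs , cong₂ _∷_ (cong suc (∷-injectiveˡ e)) (∷-injectiveʳ e)

descents-above : ∀ acc α → IsComposition α → All (acc <_) (descents acc α)
descents-above acc []           _              = []
descents-above acc (a ∷ [])     _              = []
descents-above acc (a ∷ b ∷ α) (0<a ∷ parts) =
  acc<acc+a ∷ All.map (<-trans acc<acc+a) (descents-above (acc + a) (b ∷ α) parts)
  where acc<acc+a = m<m+n acc 0<a

descents-shift : ∀ j a α → descents j (suc a ∷ α) ≡ descents (suc j) (a ∷ α)
descents-shift j a []      = refl
descents-shift j a (b ∷ α) = cong (λ d → d ∷ descents d (b ∷ α)) (+-suc j a)

descents-1∷ : ∀ j a α → descents j (1 ∷ a ∷ α) ≡ suc j ∷ descents (suc j) (a ∷ α)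
descents-1∷ j a α = cong (λ d → d ∷ descents d (a ∷ α)) (+-comm j 1)

∈ᵇ-head : ∀ i D → (i ∈ᵇ (i ∷ D)) ≡ true
∈ᵇ-head i D = cong (_∨ (i ∈ᵇ D)) (T-ext _ (λ _ → ≡⇒≡ᵇ i i refl))

≢⇒≡ᵇ-false : ∀ {m n} → m ≢ n → (m ≡ᵇ n) ≡ false
≢⇒≡ᵇ-false {m} {n} m≢n = T-ext (m≢n ∘ ≡ᵇ⇒≡ m n) λ ()

∈ᵇ-above : ∀ {i} D → All (i <_) D → (i ∈ᵇ D) ≡ false
∈ᵇ-above []      []          = refl
∈ᵇ-above (d ∷ D) (i<d ∷ i<D) =
  cong₂ _∨_ (≢⇒≡ᵇ-false (≢-sym (<⇒≢ i<d))) (∈ᵇ-above D i<D)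

seqOK-below : ∀ {d i} D ss → d < i → seqOK (d ∷ D) i ss ≡ seqOK D i ss
seqOK-below D []            _   = refl
seqOK-below D (_ ∷ [])      _   = refl
seqOK-below {i = i} D (S ∷ S′ ∷ ss) d<i =
  cong₂ (λ b rest → stepᵇ b S S′ ∧ rest)
        (cong (_∨ (i ∈ᵇ D)) (≢⇒≡ᵇ-false (<⇒≢ d<i)))
        (seqOK-below D (S′ ∷ ss) (m≤n⇒m≤1+n d<i))

seqOK-compositionOf : ∀ j bs ss → length ss ≡ suc (length bs) →
  seqOK (descents j (compositionOf bs)) (suc j) ss ≡ chainᵇ bs ss
seqOK-compositionOf j []           (_ ∷ [])       _ = refl
seqOK-compositionOf j (true  ∷ bs) (S ∷ S′ ∷ ss) l =
  trans (cong (λ D → seqOK D (suc j) (S ∷ S′ ∷ ss)) (descents-1∷ j (firstPart bs) (laterParts bs)))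
        (cong₂ (λ b rest → stepᵇ b S S′ ∧ rest)
               (∈ᵇ-head (suc j) D)
               (trans (seqOK-below D (S′ ∷ ss) ≤-refl)
                      (seqOK-compositionOf (suc j) bs (S′ ∷ ss) (suc-injective l))))
  where D = descents (suc j) (compositionOf bs)
seqOK-compositionOf j (false ∷ bs) (S ∷ S′ ∷ ss) l =
  trans (cong (λ D → seqOK D (suc j) (S ∷ S′ ∷ ss)) (descents-shift j (firstPart bs) (laterParts bs)))
        (cong₂ (λ b rest → stepᵇ b S S′ ∧ rest)
               (∈ᵇ-above D (descents-above (suc j) (compositionOf bs) (compositionOf-isComposition bs)))
               (seqOK-compositionOf (suc j) bs (S′ ∷ ss) (suc-injective l)))
  where D = descents (suc j) (compositionOf bs)

Ltilde-compositionOf : ∀ n bs →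
  Ltilde n (compositionOf bs) ≡ map concat (filterᵇ (chainᵇ bs) (seqs n (suc (length bs))))
Ltilde-compositionOf n bs = begin
  map concat (filterᵇ (seqOK D 1) (seqs n (sum (compositionOf bs))))
    ≡⟨ cong (λ k → map concat (filterᵇ (seqOK D 1) (seqs n k))) (sum-compositionOf bs) ⟩
  map concat (filterᵇ (seqOK D 1) (seqs n (suc (length bs))))
    ≡⟨ cong (map concat) (filterᵇ-cong-local
         (All.map (λ {ss} (l , _) → seqOK-compositionOf 0 bs ss l)
                  (seqs-labels n (suc (length bs))))) ⟩
  map concat (filterᵇ (chainᵇ bs) (seqs n (suc (length bs)))) ∎
  where
  open ≡-Reasoning
  D = descents 0 (compositionOf bs)

forestGrove : ℕ → ℕ → Forest → Poly
forestGrove N s F = map weightF (filterᵇ (compatF s) (labelingsF N F))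

forestGrove-leaves : ∀ N s a F → forestGrove N s (replicate a leaf ++ F) ≡ forestGrove N (s + a) F
forestGrove-leaves N s zero    F = cong (λ x → forestGrove N x F) (sym (+-identityʳ s))
forestGrove-leaves N s (suc a) F = begin
  map weightF (filterᵇ (compatF s) (map (lleaf ∷_) (labelingsF N F′) ++ []))
    ≡⟨ cong (map weightF ∘ filterᵇ (compatF s)) (++-identityʳ (map (lleaf ∷_) (labelingsF N F′))) ⟩
  map weightF (filterᵇ (compatF s) (map (lleaf ∷_) (labelingsF N F′)))
    ≡⟨ cong (map weightF) (filterᵇ-map (compatF s) (lleaf ∷_) (labelingsF N F′)) ⟩
  map weightF (map (lleaf ∷_) (filterᵇ (compatF (s + 1)) (labelingsF N F′)))
    ≡⟨ map-∘ _ ⟨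
  forestGrove N (s + 1) F′            ≡⟨ forestGrove-leaves N (s + 1) a F ⟩
  forestGrove N (s + 1 + a) F         ≡⟨ cong (λ x → forestGrove N x F) (+-assoc s 1 a) ⟩
  forestGrove N (s + suc a) F         ∎
  where
  open ≡-Reasoning
  F′ = replicate a leaf ++ F

labelingsF-trivial : ∀ N c → labelingsF N (replicate c leaf) ≡ [ replicate c lleaf ]
labelingsF-trivial N zero    = refl
labelingsF-trivial N (suc c) = trans (++-identityʳ _) (cong (map (lleaf ∷_)) (labelingsF-trivial N c))

compatF-trivial : ∀ s c → T (compatF s (replicate c lleaf))
compatF-trivial s zero    = tt
compatF-trivial s (suc c) = compatF-trivial (s + 1) c

weightF-trivial : ∀ c → weightF (replicate c lleaf) ≡ []
weightF-trivial zero    = refl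
weightF-trivial (suc c) = weightF-trivial c

forestGrove-trivial : ∀ N s c → forestGrove N s (replicate c leaf) ≡ [ [] ]
forestGrove-trivial N s c = begin
  map weightF (filterᵇ (compatF s) (labelingsF N (replicate c leaf)))
    ≡⟨ cong (map weightF ∘ filterᵇ (compatF s)) (labelingsF-trivial N c) ⟩
  map weightF (filterᵇ (compatF s) [ replicate c lleaf ])
    ≡⟨ cong (map weightF) (filter-accept (T? ∘ compatF s) {x = replicate c lleaf} {xs = []}
                                         (compatF-trivial s c)) ⟩
  [ weightF (replicate c lleaf) ]   ≡⟨ cong [_] (weightF-trivial c) ⟩
  [ [] ]                            ∎
  where open ≡-Reasoning

compatF-∷-trivial : ∀ s L c → compatF s (L ∷ replicate c lleaf) ≡ compatT s L
compatF-∷-trivial s L c = T-ext (proj₁ ∘ T-∧⁻) (λ cL → T-∧⁺ cL (compatF-trivial (s + lleaves L) c))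

weightF-∷-trivial : ∀ L c → weightF (L ∷ replicate c lleaf) ≡ weightT L
weightF-∷-trivial L c = trans (cong (weightT L ++_) (weightF-trivial c)) (++-identityʳ (weightT L))

forestGrove-single : ∀ N s t c → forestGrove N s (t ∷ replicate c leaf) ≡ treeGrove N s t
forestGrove-single N s t c = begin
  map weightF (filterᵇ (compatF s) (concatMap (λ L → map (L ∷_) (labelingsF N (replicate c leaf)))
                                              (labelingsT N t)))
    ≡⟨ cong (λ Ls → map weightF (filterᵇ (compatF s) (concatMap (λ L → map (L ∷_) Ls) (labelingsT N t))))
            (labelingsF-trivial N c) ⟩
  map weightF (filterᵇ (compatF s) (concatMap (λ L → [ L ∷ trivial ]) (labelingsT N t)))
    ≡⟨ cong (map weightF ∘ filterᵇ (compatF s)) (concatMap-[_]∘ (_∷ trivial) (labelingsT N t)) ⟩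
  map weightF (filterᵇ (compatF s) (map (_∷ trivial) (labelingsT N t)))
    ≡⟨ cong (map weightF) (filterᵇ-map (compatF s) (_∷ trivial) (labelingsT N t)) ⟩
  map weightF (map (_∷ trivial) (filterᵇ (compatF s ∘ (_∷ trivial)) (labelingsT N t)))
    ≡⟨ map-∘ _ ⟨
  map (weightF ∘ (_∷ trivial)) (filterᵇ (compatF s ∘ (_∷ trivial)) (labelingsT N t))
    ≡⟨ map-cong (λ L → weightF-∷-trivial L c) _ ⟩
  map weightT (filterᵇ (compatF s ∘ (_∷ trivial)) (labelingsT N t))
    ≡⟨ cong (map weightT) (filterᵇ-cong-local {xs = labelingsT N t}
                                                (All.tabulate (λ {L} _ → compatF-∷-trivial s L c))) ⟩
  map weightT (filterᵇ (compatT s) (labelingsT N t)) ∎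
  where
  open ≡-Reasoning
  trivial = replicate c lleaf

leavesF-leaves : ∀ a F → leavesF (replicate a leaf ++ F) ≡ a + leavesF F
leavesF-leaves zero    F = refl
leavesF-leaves (suc a) F = cong suc (leavesF-leaves a F)

trues<leaves : ∀ bs → trues bs < leaves (caterpillar bs)
trues<leaves []           = z<s
trues<leaves (true  ∷ bs) = s≤s (trues<leaves bs)
trues<leaves (false ∷ bs) = ≤-trans (trues<leaves bs) (m≤m+n _ 1)

cherry≤leavesF : ∀ a bs c →
  suc a + trues bs ≤ leavesF (replicate a leaf ++ caterpillar bs ∷ replicate c leaf)
cherry≤leavesF a bs c = begin
  suc (a + trues bs)                               ≡⟨ +-suc a (trues bs) ⟨
  a + suc (trues bs)                               ≤⟨ +-monoʳ-≤ a (trues<leaves bs) ⟩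
  a + leaves (caterpillar bs)                      ≤⟨ +-monoʳ-≤ a (m≤m+n _ _) ⟩
  a + leavesF (caterpillar bs ∷ replicate c leaf)  ≡⟨ leavesF-leaves a _ ⟨
  leavesF (replicate a leaf ++ caterpillar bs ∷ replicate c leaf) ∎
  where open ≤-Reasoning

grove-trivial : ∀ c → grove (replicate c leaf) ≡ [ [] ]
grove-trivial c = forestGrove-trivial _ 1 c

grove-single : ∀ a bs c →
  grove (replicate a leaf ++ caterpillar bs ∷ replicate c leaf) ≡
  Ltilde (suc a + trues bs) (compositionOf bs)
grove-single a bs c = begin
  forestGrove N 1 (replicate a leaf ++ caterpillar bs ∷ replicate c leaf)
    ≡⟨ forestGrove-leaves N 1 a _ ⟩
  forestGrove N (suc a) (caterpillar bs ∷ replicate c leaf)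
    ≡⟨ forestGrove-single N (suc a) (caterpillar bs) c ⟩
  treeGrove N (suc a) (caterpillar bs)
    ≡⟨ treeGrove-caterpillar (suc a) bs (≤⇒≤′ (cherry≤leavesF a bs c)) ⟩
  map concat (filterᵇ (chainᵇ bs) (seqs (suc a + trues bs) (suc (length bs))))
    ≡⟨ Ltilde-compositionOf (suc a + trues bs) bs ⟨
  Ltilde (suc a + trues bs) (compositionOf bs)
    ∎
  where
  open ≡-Reasoning
  N = leavesF (replicate a leaf ++ caterpillar bs ∷ replicate c leaf)

-- Zig forests

cherry-leaf-caterpillar : ∀ bs {s} → cherry leaf (caterpillar bs) s ≡ []
cherry-leaf-caterpillar []          = refl
cherry-leaf-caterpillar (true  ∷ _) = refl
cherry-leaf-caterpillar (false ∷ _) = refl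

cherry-caterpillar-leaf : ∀ bs {s} → cherry (caterpillar bs) leaf s ≡ []
cherry-caterpillar-leaf []          = refl
cherry-caterpillar-leaf (true  ∷ _) = refl
cherry-caterpillar-leaf (false ∷ _) = refl

cherries-caterpillar : ∀ s bs → cherries s (caterpillar bs) ≡ [ s + trues bs ]
cherries-caterpillar s [] = cong [_] (sym (+-identityʳ s))
cherries-caterpillar s (true ∷ bs)
  rewrite cherry-leaf-caterpillar bs {s} | cherries-caterpillar (s + 1) bs =
  cong [_] (+-assoc s 1 (trues bs))
cherries-caterpillar s (false ∷ bs)
  rewrite cherry-caterpillar-leaf bs {s} | cherries-caterpillar s bs = refl

qdesFrom-leaves : ∀ s a F → qdesFrom s (replicate a leaf ++ F) ≡ qdesFrom (s + a) F
qdesFrom-leaves s zero    F = cong (λ x → qdesFrom x F) (sym (+-identityʳ s))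
qdesFrom-leaves s (suc a) F =
  trans (qdesFrom-leaves (s + 1) a F) (cong (λ x → qdesFrom x F) (+-assoc s 1 a))

qdesFrom-trivial : ∀ s c → qdesFrom s (replicate c leaf) ≡ []
qdesFrom-trivial s zero    = refl
qdesFrom-trivial s (suc c) = qdesFrom-trivial (s + 1) c

-- With leaves numbered from s, the trees and forests all of whose cherries are at n.
data ZigTree (s n : ℕ) : Tree → Set where
  leaf  : ZigTree s n leaf
  spine : ∀ bs → s + trues bs ≡ n → ZigTree s n (caterpillar bs)

data ZigForest (s n : ℕ) : Forest → Set where
  trivial : ∀ c → ZigForest s n (replicate c leaf)
  single  : ∀ a bs c → s + a + trues bs ≡ n →
            ZigForest s n (replicate a leaf ++ caterpillar bs ∷ replicate c leaf)

cherries-apart : ∀ s bs m → s + trues bs ≢ s + leaves (caterpillar bs) + m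
cherries-apart s bs m = <⇒≢ (≤-trans (+-monoʳ-< s (trues<leaves bs)) (m≤m+n _ m))

zigTree : ∀ s n t → All (_≡ n) (cherries s t) → ZigTree s n t
zigTree s n leaf       _ = leaf
zigTree s n (node l r) h
  with zigTree s n l (++⁻ˡ (cherries s l) (++⁻ʳ (cherry l r s) h))
     | zigTree (s + leaves l) n r (++⁻ʳ (cherries s l) (++⁻ʳ (cherry l r s) h))
... | leaf        | leaf        = spine [] (trans (+-identityʳ s) (All.head h))
... | leaf        | spine bs e  = spine (true ∷ bs) (trans (sym (+-assoc s 1 (trues bs))) e)
... | spine bs e  | leaf        = spine (false ∷ bs) e
... | spine bs e  | spine bs′ e′ = ⊥-elim (cherries-apart s bs (trues bs′) (trans e (sym e′)))

zigForest-complete : ∀ s n Z → All (_≡ n) (qdesFrom s Z) → ZigForest s n Z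
zigForest-complete s n []      _ = trivial 0
zigForest-complete s n (t ∷ Z) h
  with zigTree s n t (++⁻ˡ (cherries s t) h)
     | zigForest-complete (s + leaves t) n Z (++⁻ʳ (cherries s t) h)
... | leaf       | trivial c         = trivial (suc c)
... | leaf       | single a bs c e   = single (suc a) bs c (trans (cong (_+ trues bs) (sym (+-assoc s 1 a))) e)
... | spine bs e | trivial c         = single 0 bs c (trans (cong (_+ trues bs) (+-identityʳ s)) e)
... | spine bs e | single a bs′ c e′ =
  ⊥-elim (cherries-apart s bs (a + trues bs′) (trans e (sym (trans (sym (+-assoc _ a (trues bs′))) e′))))

zigForest-sound : ∀ {s n Z} → ZigForest s n Z → All (_≡ n) (qdesFrom s Z)
zigForest-sound {s} {n} (trivial c) = subst (All (_≡ n)) (sym (qdesFrom-trivial s c)) []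
zigForest-sound {s} {n} (single a bs c e) = subst (All (_≡ n)) (sym qdes) (e ∷ [])
  where
  qdes : qdesFrom s (replicate a leaf ++ caterpillar bs ∷ replicate c leaf) ≡ [ s + a + trues bs ]
  qdes = trans (qdesFrom-leaves s a _)
               (cong₂ _++_ (cherries-caterpillar (s + a) bs) (qdesFrom-trivial _ c))

≡⇒≈P : ∀ {P Q} → P ≡ Q → P ≈P Q
≡⇒≈P = ↭-reflexive ∘ cong (map sortℕ)

proposition6p1 : (n : ℕ) → 1 ≤ n →
    ((Z : Forest) → InZig n Z →
    Σ (List ℕ) (λ α → IsComposition α × length α ≤ n × grove Z ≈P Ltilde n α))
    × ((α : List ℕ) → IsComposition α → length α ≤ n →
    Σ Forest (λ Z → InZig n Z × grove Z ≈P Ltilde n α))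
proposition6p1 n _ = zig⇒Ltilde , Ltilde⇒zig
  where
  zig⇒Ltilde : (Z : Forest) → InZig n Z →
    Σ (List ℕ) (λ α → IsComposition α × length α ≤ n × grove Z ≈P Ltilde n α)
  zig⇒Ltilde Z h with zigForest-complete 1 n Z h
  ... | trivial c = [] , [] , z≤n , ≡⇒≈P (grove-trivial c)
  ... | single a bs c refl =
    compositionOf bs , compositionOf-isComposition bs ,
    ≤-trans (≤-reflexive (length-compositionOf bs)) (s≤s (m≤n+m (trues bs) a)) ,
    ≡⇒≈P (grove-single a bs c)

  Ltilde⇒zig : (α : List ℕ) → IsComposition α → length α ≤ n →
    Σ Forest (λ Z → InZig n Z × grove Z ≈P Ltilde n α)
  Ltilde⇒zig []      _     _   = [] , [] , ≡⇒≈P {[ [] ]} refl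
  Ltilde⇒zig (a ∷ α) parts len with compositionOf-surjective parts
  ... | bs , refl =
    replicate a′ leaf ++ caterpillar bs ∷ [] , zigForest-sound (single a′ bs 0 cherry≡n) ,
    ≡⇒≈P (trans (grove-single a′ bs 0) (cong (λ m → Ltilde m (compositionOf bs)) cherry≡n))
    where
    a′ = n ∸ suc (trues bs)
    cherry≡n : suc a′ + trues bs ≡ n
    cherry≡n = trans (sym (+-suc a′ (trues bs)))
                     (m∸n+n≡m (subst (_≤ n) (length-compositionOf bs) len))
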